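{- Let $G = (V = L \cup R, E)$ be a bipartite graph with $|L|, |R| \le n$, let $\varepsilon \in (0,1)$, and let $A \subseteq L$, $B \subseteq R$. Let $G^+$ be the graph obtained from $G$ by adding, for each $a \in L \setminus A$, a new vertex $a'$ and the edge $(a,a')$, and for each $b \in R \setminus B$, a new vertex $b'$ and the edge $(b',b)$, where all the new vertices are distinct. Let $C$ be a vertex cover of $G^+$ with $|C| \le (1+\varepsilon)\tau(G^+)$. Then $C \cap (A \cup B)$ is a vertex cover of $G[A,B]$ with $|C \cap (A\cup B)| \le \tau(G[A,B]) + 2\varepsilon n$.
   Context: $\tau(H)$ denotes the minimum vertex cover size of a graph $H$ (equal to its maximum matching size for bipartite $H$). For $A \subseteq L$, $B \subseteq R$, $G[A,B]$ is the graph with vertex set $A \cup B$ and edges $\{(a,b) \in E : a \in A, b \in B\}$.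
   Formalization: The parameter ε ranges over the rationals strictly between 0 and 1. -}

module Defs where

open import Data.Nat using (ℕ; _+_; _≤_)
open import Data.Fin using (Fin; splitAt)
open import Data.Fin.Subset using (Subset; _∈_; _⊆_; ∣_∣; ⊤; ∁; _∩_)
open import Data.Vec using (_++_; take)
open import Data.Sum using (_⊎_; inj₁; inj₂)
open import Data.Product using (_×_; _,_; Σ-syntax)
open import Data.Empty using (⊥)
open import Relation.Binary.PropositionalEquality using (_≡_)

-- A bipartite graph: left vertices form a subset VL of Fin nL, right vertices
-- a subset VR of Fin nR; the edges are the pairs (a , b) with a ∈ VL, b ∈ VR
-- and adj a b.
record BipGraph : Set₁ where
  field
    nL nR : ℕ
    VL    : Subset nL
    VR    : Subset nR
    adj   : Fin nL → Fin nR → Set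
open BipGraph public

VSet : BipGraph → Set
VSet H = Subset (nL H) × Subset (nR H)

size : (H : BipGraph) → VSet H → ℕ
size H (X , Y) = ∣ X ∣ + ∣ Y ∣

IsVertexCover : (H : BipGraph) → VSet H → Set
IsVertexCover H (X , Y) =
  (X ⊆ VL H) × (Y ⊆ VR H) ×
  (∀ a b → a ∈ VL H → b ∈ VR H → adj H a b → (a ∈ X ⊎ b ∈ Y))

IsTau : BipGraph → ℕ → Set
IsTau H t =
  (Σ[ C ∈ VSet H ] (IsVertexCover H C × size H C ≡ t)) ×
  (∀ C → IsVertexCover H C → t ≤ size H C)

G : (p q : ℕ) → (Fin p → Fin q → Set) → BipGraph
G p q E = record { nL = p ; nR = q ; VL = ⊤ ; VR = ⊤ ; adj = E }

G[_,_] : ∀ {p q} → Subset p → Subset q → (Fin p → Fin q → Set) → BipGraph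
G[_,_] {p} {q} A B E = record { nL = p ; nR = q ; VL = A ; VR = B ; adj = E }

-- G⁺ : left side  = L ⊎ {b' : b ∈ R ∖ B}  (indexed by Fin (p + q)),
--      right side = R ⊎ {a' : a ∈ L ∖ A}  (indexed by Fin (q + p)).
plusAdj : ∀ p q → (Fin p → Fin q → Set) → Fin (p + q) → Fin (q + p) → Set
plusAdj p q E x y with splitAt p x | splitAt q y
... | inj₁ a  | inj₁ b  = E a b
... | inj₁ a  | inj₂ a' = a ≡ a'
... | inj₂ b' | inj₁ b  = b' ≡ b
... | inj₂ _  | inj₂ _  = ⊥

G⁺ : ∀ {p q} → Subset p → Subset q → (Fin p → Fin q → Set) → BipGraph
G⁺ {p} {q} A B E = record
  { nL = p + q ; nR = q + p
  ; VL = ⊤ ++ ∁ B ; VR = ⊤ ++ ∁ A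
  ; adj = plusAdj p q E }

restrict : ∀ {p q} (A : Subset p) (B : Subset q) (E : Fin p → Fin q → Set) →
           VSet (G⁺ A B E) → VSet (G[ A , B ] E)
restrict {p} {q} A B E (X , Y) = (take p X ∩ A , take q Y ∩ B)

{-# OPTIONS --safe #-}

-- Let k = |L ∖ A| + |R ∖ B| be the number of pendant edges of G⁺. They are pairwise disjoint and
-- have no endpoint in A ∪ B, so a cover C of G⁺ spends k vertices on them outside A ∪ B:
-- |C ∩ (A ∪ B)| + k ≤ |C|. Conversely, a minimum cover of G[A,B] together with L ∖ A and R ∖ B
-- covers G⁺, so τ(G⁺) ≤ τ(G[A,B]) + k; and L ∪ R covers G⁺, so τ(G⁺) ≤ 2n. Hence
-- |C ∩ (A ∪ B)| ≤ (1 + ε) τ(G⁺) − k ≤ τ(G[A,B]) + ε τ(G⁺) ≤ τ(G[A,B]) + 2εn.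

module Submission where

open import Defs
open import Data.Nat using (ℕ; _≤_)
open import Data.Rational using () renaming (_≤_ to _≤ℚ_)
open import Data.Fin using (Fin)
open import Data.Fin.Subset using (Subset)
open import Data.Integer using (+_)
open import Data.Rational using (ℚ; _/_; 0ℚ; 1ℚ; _+_; _*_; _<_)
open import Data.Product using (_×_)

import Algebra.Properties.CommutativeSemigroup as CommutativeSemigroupProperties
import Algebra.Properties.Group as GroupProperties
open import Algebra.Bundles using (CommutativeMonoid)
import Data.Integer as ℤ
import Data.Integer.Properties as ℤ
import Data.Nat as ℕ
import Data.Nat.Properties as ℕ
open import Data.Nat.Coprimality using (1-coprimeTo) renaming (sym to coprime-sym)
import Data.Rational as ℚ
import Data.Rational.Properties as ℚ
open import Data.Rational.Solver using (module +-*-Solver)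
open import Data.Empty as Empty using (⊥-elim)
open import Data.Fin using (zero; suc; splitAt; _↑ˡ_; _↑ʳ_)
open import Data.Fin.Properties using (splitAt-↑ˡ; splitAt-↑ʳ; splitAt⁻¹-↑ˡ; splitAt⁻¹-↑ʳ)
open import Data.Fin.Subset using (_∈_; _⊆_; ∣_∣; ⊤; ⊥; ∁; _∩_; _∪_; inside; outside)
open import Data.Fin.Subset.Properties
  using (∈⊤; ⊥⊆; ∣⊤∣≡n; ∣⊥∣≡0; p⊆q⇒∣p∣≤∣q∣; x∈p∩q⁺; p∩q⊆q; x∈p∪q⁺; x∈p∪q⁻;
         p⊆p∪q; q⊆p∪q; x∉p⇒x∈∁p; _∈?_)
open import Data.Product using (_,_)
open import Data.Sum as Sum using (_⊎_; inj₁; inj₂)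
open import Data.Vec using ([]; _∷_; _++_; take; drop; here; there)
open import Data.Vec.Properties using (take++drop≡id)
open import Function using (id)
open import Relation.Nullary using (yes; no)
open import Relation.Binary.PropositionalEquality

open CommutativeSemigroupProperties ℕ.+-commutativeSemigroup using (interchange)

data SplitView (m : ℕ) {n : ℕ} : Fin (m ℕ.+ n) → Set where
  left  : (i : Fin m) → SplitView m (i ↑ˡ n)
  right : (j : Fin n) → SplitView m (m ↑ʳ j)

splitView : ∀ m {n} (x : Fin (m ℕ.+ n)) → SplitView m x
splitView m x with splitAt m x in eq
... | inj₁ i = subst (SplitView m) (splitAt⁻¹-↑ˡ eq) (left i)
... | inj₂ j = subst (SplitView m) (splitAt⁻¹-↑ʳ eq) (right j)

∈-++⁺ˡ : ∀ {m n} {p : Subset m} {q : Subset n} {i : Fin m} → i ∈ p → i ↑ˡ n ∈ p ++ q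
∈-++⁺ˡ here        = here
∈-++⁺ˡ (there i∈p) = there (∈-++⁺ˡ i∈p)

∈-++⁻ˡ : ∀ {m n} {p : Subset m} {q : Subset n} (i : Fin m) → i ↑ˡ n ∈ p ++ q → i ∈ p
∈-++⁻ˡ {p = _ ∷ _} zero    here         = here
∈-++⁻ˡ {p = _ ∷ _} (suc i) (there i∈pq) = there (∈-++⁻ˡ i i∈pq)

∈-++⁺ʳ : ∀ {m n} (p : Subset m) {q : Subset n} {j : Fin n} → j ∈ q → m ↑ʳ j ∈ p ++ q
∈-++⁺ʳ []      j∈q = j∈q
∈-++⁺ʳ (_ ∷ p) j∈q = there (∈-++⁺ʳ p j∈q)

∈-++⁻ʳ : ∀ {m n} (p : Subset m) {q : Subset n} {j : Fin n} → m ↑ʳ j ∈ p ++ q → j ∈ q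
∈-++⁻ʳ []      j∈pq         = j∈pq
∈-++⁻ʳ (_ ∷ p) (there j∈pq) = ∈-++⁻ʳ p j∈pq

++-mono-⊆ : ∀ {m n} {p p′ : Subset m} {q q′ : Subset n} →
            p ⊆ p′ → q ⊆ q′ → p ++ q ⊆ p′ ++ q′
++-mono-⊆ {m} {p = p} p⊆p′ q⊆q′ {x} x∈pq with splitView m x
... | left i  = ∈-++⁺ˡ (p⊆p′ (∈-++⁻ˡ i x∈pq))
... | right j = ∈-++⁺ʳ _ (q⊆q′ (∈-++⁻ʳ p x∈pq))

∣p++q∣≡∣p∣+∣q∣ : ∀ {m n} (p : Subset m) (q : Subset n) → ∣ p ++ q ∣ ≡ ∣ p ∣ ℕ.+ ∣ q ∣
∣p++q∣≡∣p∣+∣q∣ []            q = refl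
∣p++q∣≡∣p∣+∣q∣ (inside  ∷ p) q = cong ℕ.suc (∣p++q∣≡∣p∣+∣q∣ p q)
∣p++q∣≡∣p∣+∣q∣ (outside ∷ p) q = ∣p++q∣≡∣p∣+∣q∣ p q

∣p++⊥∣≡∣p∣ : ∀ {m n} (p : Subset m) → ∣ p ++ ⊥ {n} ∣ ≡ ∣ p ∣
∣p++⊥∣≡∣p∣ {n = n} p = begin
  ∣ p ++ ⊥ ∣           ≡⟨ ∣p++q∣≡∣p∣+∣q∣ p ⊥ ⟩
  ∣ p ∣ ℕ.+ ∣ ⊥ {n} ∣  ≡⟨ cong (∣ p ∣ ℕ.+_) (∣⊥∣≡0 n) ⟩
  ∣ p ∣ ℕ.+ 0          ≡⟨ ℕ.+-identityʳ ∣ p ∣ ⟩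
  ∣ p ∣                ∎
  where open ≡-Reasoning

module _ (m : ℕ) {n : ℕ} (p : Subset (m ℕ.+ n)) where

  ∈-take⁺ : {i : Fin m} → i ↑ˡ n ∈ p → i ∈ take m p
  ∈-take⁺ {i} i∈p = ∈-++⁻ˡ i (subst (i ↑ˡ n ∈_) (sym (take++drop≡id m p)) i∈p)

  ∈-drop⁺ : {j : Fin n} → m ↑ʳ j ∈ p → j ∈ drop m p
  ∈-drop⁺ {j} j∈p = ∈-++⁻ʳ (take m p) (subst (m ↑ʳ j ∈_) (sym (take++drop≡id m p)) j∈p)

  ∣take∣+∣drop∣≡∣p∣ : ∣ take m p ∣ ℕ.+ ∣ drop m p ∣ ≡ ∣ p ∣
  ∣take∣+∣drop∣≡∣p∣ = trans (sym (∣p++q∣≡∣p∣+∣q∣ (take m p) (drop m p))) (cong ∣_∣ (take++drop≡id m p))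

∣p∪q∣≤∣p∣+∣q∣ : ∀ {m} (p q : Subset m) → ∣ p ∪ q ∣ ≤ ∣ p ∣ ℕ.+ ∣ q ∣
∣p∪q∣≤∣p∣+∣q∣ []            []            = ℕ.z≤n
∣p∪q∣≤∣p∣+∣q∣ (inside  ∷ p) (inside  ∷ q) =
  ℕ.s≤s (ℕ.≤-trans (∣p∪q∣≤∣p∣+∣q∣ p q) (ℕ.+-monoʳ-≤ ∣ p ∣ (ℕ.n≤1+n ∣ q ∣)))
∣p∪q∣≤∣p∣+∣q∣ (inside  ∷ p) (outside ∷ q) = ℕ.s≤s (∣p∪q∣≤∣p∣+∣q∣ p q)
∣p∪q∣≤∣p∣+∣q∣ (outside ∷ p) (inside  ∷ q) =
  subst (ℕ.suc ∣ p ∪ q ∣ ≤_) (sym (ℕ.+-suc (∣ p ∣) (∣ q ∣))) (ℕ.s≤s (∣p∪q∣≤∣p∣+∣q∣ p q))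
∣p∪q∣≤∣p∣+∣q∣ (outside ∷ p) (outside ∷ q) = ∣p∪q∣≤∣p∣+∣q∣ p q

∣p∩q∣+∣p∩∁q∣≡∣p∣ : ∀ {m} (p q : Subset m) → ∣ p ∩ q ∣ ℕ.+ ∣ p ∩ ∁ q ∣ ≡ ∣ p ∣
∣p∩q∣+∣p∩∁q∣≡∣p∣ []            []            = refl
∣p∩q∣+∣p∩∁q∣≡∣p∣ (inside  ∷ p) (inside  ∷ q) = cong ℕ.suc (∣p∩q∣+∣p∩∁q∣≡∣p∣ p q)
∣p∩q∣+∣p∩∁q∣≡∣p∣ (inside  ∷ p) (outside ∷ q) =
  trans (ℕ.+-suc (∣ p ∩ q ∣) (∣ p ∩ ∁ q ∣)) (cong ℕ.suc (∣p∩q∣+∣p∩∁q∣≡∣p∣ p q))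
∣p∩q∣+∣p∩∁q∣≡∣p∣ (outside ∷ p) (_       ∷ q) = ∣p∩q∣+∣p∩∁q∣≡∣p∣ p q

∁r⊆p∪q⇒∣p∩r∣+∣∁r∣≤∣p∣+∣q∣ : ∀ {m} (p q r : Subset m) → ∁ r ⊆ p ∪ q →
                            ∣ p ∩ r ∣ ℕ.+ ∣ ∁ r ∣ ≤ ∣ p ∣ ℕ.+ ∣ q ∣
∁r⊆p∪q⇒∣p∩r∣+∣∁r∣≤∣p∣+∣q∣ p q r ∁r⊆p∪q = begin
  ∣ p ∩ r ∣ ℕ.+ ∣ ∁ r ∣                     ≤⟨ ℕ.+-monoʳ-≤ ∣ p ∩ r ∣ (p⊆q⇒∣p∣≤∣q∣ ∁r⊆[p∩∁r]∪q) ⟩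
  ∣ p ∩ r ∣ ℕ.+ ∣ p ∩ ∁ r ∪ q ∣             ≤⟨ ℕ.+-monoʳ-≤ ∣ p ∩ r ∣ (∣p∪q∣≤∣p∣+∣q∣ (p ∩ ∁ r) q) ⟩
  ∣ p ∩ r ∣ ℕ.+ (∣ p ∩ ∁ r ∣ ℕ.+ ∣ q ∣)     ≡⟨ ℕ.+-assoc (∣ p ∩ r ∣) (∣ p ∩ ∁ r ∣) (∣ q ∣) ⟨
  ∣ p ∩ r ∣ ℕ.+ ∣ p ∩ ∁ r ∣ ℕ.+ ∣ q ∣       ≡⟨ cong (ℕ._+ ∣ q ∣) (∣p∩q∣+∣p∩∁q∣≡∣p∣ p r) ⟩
  ∣ p ∣ ℕ.+ ∣ q ∣                           ∎
  where
  open ℕ.≤-Reasoning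
  ∁r⊆[p∩∁r]∪q : ∁ r ⊆ p ∩ ∁ r ∪ q
  ∁r⊆[p∩∁r]∪q i∈∁r = x∈p∪q⁺ (Sum.map₁ (λ i∈p → x∈p∩q⁺ (i∈p , i∈∁r)) (x∈p∪q⁻ p q (∁r⊆p∪q i∈∁r)))

module _ {p q : ℕ} (E : Fin p → Fin q → Set) where

  plusAdj-↑ˡ-↑ˡ : ∀ a b → plusAdj p q E (a ↑ˡ q) (b ↑ˡ p) ≡ E a b
  plusAdj-↑ˡ-↑ˡ a b rewrite splitAt-↑ˡ p a q | splitAt-↑ˡ q b p = refl

  plusAdj-↑ˡ-↑ʳ : ∀ a a′ → plusAdj p q E (a ↑ˡ q) (q ↑ʳ a′) ≡ (a ≡ a′)
  plusAdj-↑ˡ-↑ʳ a a′ rewrite splitAt-↑ˡ p a q | splitAt-↑ʳ q p a′ = refl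

  plusAdj-↑ʳ-↑ˡ : ∀ b′ b → plusAdj p q E (p ↑ʳ b′) (b ↑ˡ p) ≡ (b′ ≡ b)
  plusAdj-↑ʳ-↑ˡ b′ b rewrite splitAt-↑ʳ p q b′ | splitAt-↑ˡ q b p = refl

  plusAdj-↑ʳ-↑ʳ : ∀ b′ a′ → plusAdj p q E (p ↑ʳ b′) (q ↑ʳ a′) ≡ Empty.⊥
  plusAdj-↑ʳ-↑ʳ b′ a′ rewrite splitAt-↑ʳ p q b′ | splitAt-↑ʳ q p a′ = refl

pendants : ∀ {p q} → Subset p → Subset q → ℕ
pendants A B = ∣ ∁ A ∣ ℕ.+ ∣ ∁ B ∣

module _ {p q : ℕ} (A : Subset p) (B : Subset q) (E : Fin p → Fin q → Set) where

  restrict-isVertexCover : ∀ C → IsVertexCover (G⁺ A B E) C →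
                           IsVertexCover (G[ A , B ] E) (restrict A B E C)
  restrict-isVertexCover (X , Y) (_ , _ , covers) =
    p∩q⊆q (take p X) A , p∩q⊆q (take q Y) B , λ a b a∈A b∈B e →
      Sum.map (λ a∈X → x∈p∩q⁺ (∈-take⁺ p X a∈X , a∈A)) (λ b∈Y → x∈p∩q⁺ (∈-take⁺ q Y b∈Y , b∈B))
        (covers (a ↑ˡ q) (b ↑ˡ p) (∈-++⁺ˡ ∈⊤) (∈-++⁺ˡ ∈⊤) (subst id (sym (plusAdj-↑ˡ-↑ˡ E a b)) e))

  size-restrict+pendants≤size : ∀ C → IsVertexCover (G⁺ A B E) C →
    size (G[ A , B ] E) (restrict A B E C) ℕ.+ pendants A B ≤ size (G⁺ A B E) C
  size-restrict+pendants≤size (X , Y) (_ , _ , covers) = begin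
    (∣ XL ∩ A ∣ ℕ.+ ∣ YR ∩ B ∣) ℕ.+ (∣ ∁ A ∣ ℕ.+ ∣ ∁ B ∣)
      ≡⟨ interchange (∣ XL ∩ A ∣) _ _ _ ⟩
    (∣ XL ∩ A ∣ ℕ.+ ∣ ∁ A ∣) ℕ.+ (∣ YR ∩ B ∣ ℕ.+ ∣ ∁ B ∣)
      ≤⟨ ℕ.+-mono-≤ (∁r⊆p∪q⇒∣p∩r∣+∣∁r∣≤∣p∣+∣q∣ XL YL A ∁A⊆XL∪YL)
                    (∁r⊆p∪q⇒∣p∩r∣+∣∁r∣≤∣p∣+∣q∣ YR XR B ∁B⊆YR∪XR) ⟩
    (∣ XL ∣ ℕ.+ ∣ YL ∣) ℕ.+ (∣ YR ∣ ℕ.+ ∣ XR ∣)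
      ≡⟨ cong ((∣ XL ∣ ℕ.+ ∣ YL ∣) ℕ.+_) (ℕ.+-comm (∣ YR ∣) (∣ XR ∣)) ⟩
    (∣ XL ∣ ℕ.+ ∣ YL ∣) ℕ.+ (∣ XR ∣ ℕ.+ ∣ YR ∣)
      ≡⟨ interchange (∣ XL ∣) _ _ _ ⟩
    (∣ XL ∣ ℕ.+ ∣ XR ∣) ℕ.+ (∣ YL ∣ ℕ.+ ∣ YR ∣)
      ≡⟨ cong ((∣ XL ∣ ℕ.+ ∣ XR ∣) ℕ.+_) (ℕ.+-comm (∣ YL ∣) (∣ YR ∣)) ⟩
    (∣ XL ∣ ℕ.+ ∣ XR ∣) ℕ.+ (∣ YR ∣ ℕ.+ ∣ YL ∣)
      ≡⟨ cong₂ ℕ._+_ (∣take∣+∣drop∣≡∣p∣ p X) (∣take∣+∣drop∣≡∣p∣ q Y) ⟩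
    ∣ X ∣ ℕ.+ ∣ Y ∣
      ∎
    where
    open ℕ.≤-Reasoning
    XL = take p X
    XR = drop p X
    YR = take q Y
    YL = drop q Y
    ∁A⊆XL∪YL : ∁ A ⊆ XL ∪ YL
    ∁A⊆XL∪YL {a} a∈∁A = x∈p∪q⁺ (Sum.map (∈-take⁺ p X) (∈-drop⁺ q Y)
      (covers (a ↑ˡ q) (q ↑ʳ a) (∈-++⁺ˡ ∈⊤) (∈-++⁺ʳ ⊤ a∈∁A) (subst id (sym (plusAdj-↑ˡ-↑ʳ E a a)) refl)))
    ∁B⊆YR∪XR : ∁ B ⊆ YR ∪ XR
    ∁B⊆YR∪XR {b} b∈∁B = x∈p∪q⁺ (Sum.swap (Sum.map (∈-drop⁺ p X) (∈-take⁺ q Y)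
      (covers (p ↑ʳ b) (b ↑ˡ p) (∈-++⁺ʳ ⊤ b∈∁B) (∈-++⁺ˡ ∈⊤)
              (subst id (sym (plusAdj-↑ʳ-↑ˡ E b b)) refl))))

  lift : Subset p → Subset q → VSet (G⁺ A B E)
  lift U V = U ++ ⊥ , V ++ ⊥

  size-lift : ∀ U V → size (G⁺ A B E) (lift U V) ≡ ∣ U ∣ ℕ.+ ∣ V ∣
  size-lift U V = cong₂ ℕ._+_ (∣p++⊥∣≡∣p∣ U) (∣p++⊥∣≡∣p∣ V)

  lift-isVertexCover : ∀ {U V} → (∀ a b → E a b → a ∈ U ⊎ b ∈ V) → ∁ A ⊆ U → ∁ B ⊆ V →
                       IsVertexCover (G⁺ A B E) (lift U V)
  lift-isVertexCover {U} {V} covers ∁A⊆U ∁B⊆V =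
    ++-mono-⊆ {p = U} (λ _ → ∈⊤) ⊥⊆ , ++-mono-⊆ {p = V} (λ _ → ∈⊤) ⊥⊆ , covers⁺
    where
    covers⁺ : ∀ x y → x ∈ ⊤ ++ ∁ B → y ∈ ⊤ ++ ∁ A → plusAdj p q E x y → x ∈ U ++ ⊥ ⊎ y ∈ V ++ ⊥
    covers⁺ x y x∈ y∈ e with splitView p x | splitView q y
    ... | left a   | left b   = Sum.map ∈-++⁺ˡ ∈-++⁺ˡ (covers a b (subst id (plusAdj-↑ˡ-↑ˡ E a b) e))
    ... | left a   | right a′ with refl ← subst id (plusAdj-↑ˡ-↑ʳ E a a′) e =
      inj₁ (∈-++⁺ˡ (∁A⊆U (∈-++⁻ʳ ⊤ y∈)))
    ... | right b′ | left b   with refl ← subst id (plusAdj-↑ʳ-↑ˡ E b′ b) e =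
      inj₂ (∈-++⁺ˡ (∁B⊆V (∈-++⁻ʳ ⊤ x∈)))
    ... | right b′ | right a′ = ⊥-elim (subst id (plusAdj-↑ʳ-↑ʳ E b′ a′) e)

  extend : VSet (G[ A , B ] E) → VSet (G⁺ A B E)
  extend (X , Y) = lift (X ∪ ∁ A) (Y ∪ ∁ B)

  extend-isVertexCover : ∀ D → IsVertexCover (G[ A , B ] E) D → IsVertexCover (G⁺ A B E) (extend D)
  extend-isVertexCover (X , Y) (_ , _ , covers) =
    lift-isVertexCover covers⁺ (q⊆p∪q X (∁ A)) (q⊆p∪q Y (∁ B))
    where
    covers⁺ : ∀ a b → E a b → a ∈ X ∪ ∁ A ⊎ b ∈ Y ∪ ∁ B
    covers⁺ a b e with a ∈? A | b ∈? B
    ... | no a∉A  | _       = inj₁ (q⊆p∪q X (∁ A) (x∉p⇒x∈∁p a∉A))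
    ... | yes _   | no b∉B  = inj₂ (q⊆p∪q Y (∁ B) (x∉p⇒x∈∁p b∉B))
    ... | yes a∈A | yes b∈B = Sum.map (p⊆p∪q (∁ A)) (p⊆p∪q (∁ B)) (covers a b a∈A b∈B e)

  size-extend≤size+pendants : ∀ D → size (G⁺ A B E) (extend D) ≤ size (G[ A , B ] E) D ℕ.+ pendants A B
  size-extend≤size+pendants (X , Y) = begin
    size (G⁺ A B E) (extend (X , Y))
      ≡⟨ size-lift (X ∪ ∁ A) (Y ∪ ∁ B) ⟩
    ∣ X ∪ ∁ A ∣ ℕ.+ ∣ Y ∪ ∁ B ∣
      ≤⟨ ℕ.+-mono-≤ (∣p∪q∣≤∣p∣+∣q∣ X (∁ A)) (∣p∪q∣≤∣p∣+∣q∣ Y (∁ B)) ⟩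
    (∣ X ∣ ℕ.+ ∣ ∁ A ∣) ℕ.+ (∣ Y ∣ ℕ.+ ∣ ∁ B ∣)
      ≡⟨ interchange (∣ X ∣) _ _ _ ⟩
    (∣ X ∣ ℕ.+ ∣ Y ∣) ℕ.+ (∣ ∁ A ∣ ℕ.+ ∣ ∁ B ∣)
      ∎
    where open ℕ.≤-Reasoning

  τ⁺≤τ+pendants : ∀ {t⁺ t} → IsTau (G⁺ A B E) t⁺ → IsTau (G[ A , B ] E) t → t⁺ ≤ t ℕ.+ pendants A B
  τ⁺≤τ+pendants {t⁺} {t} (_ , t⁺-minimal) ((D , D-covers , ∣D∣≡t) , _) = begin
    t⁺                                      ≤⟨ t⁺-minimal (extend D) (extend-isVertexCover D D-covers) ⟩
    size (G⁺ A B E) (extend D)              ≤⟨ size-extend≤size+pendants D ⟩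
    size (G[ A , B ] E) D ℕ.+ pendants A B  ≡⟨ cong (ℕ._+ pendants A B) ∣D∣≡t ⟩
    t ℕ.+ pendants A B                      ∎
    where open ℕ.≤-Reasoning

  τ⁺≤p+q : ∀ {t⁺} → IsTau (G⁺ A B E) t⁺ → t⁺ ≤ p ℕ.+ q
  τ⁺≤p+q {t⁺} (_ , t⁺-minimal) = begin
    t⁺                          ≤⟨ t⁺-minimal (lift ⊤ ⊤) ⊤-covers ⟩
    size (G⁺ A B E) (lift ⊤ ⊤)  ≡⟨ size-lift ⊤ ⊤ ⟩
    ∣ ⊤ {p} ∣ ℕ.+ ∣ ⊤ {q} ∣     ≡⟨ cong₂ ℕ._+_ (∣⊤∣≡n p) (∣⊤∣≡n q) ⟩
    p ℕ.+ q                     ∎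
    where
    open ℕ.≤-Reasoning
    ⊤-covers : IsVertexCover (G⁺ A B E) (lift ⊤ ⊤)
    ⊤-covers = lift-isVertexCover (λ _ _ _ → inj₁ ∈⊤) (λ _ → ∈⊤) (λ _ → ∈⊤)

fromℕ : ℕ → ℚ
fromℕ k = + k / 1

fromℕ≡mkℚ : ∀ k → fromℕ k ≡ ℚ.mkℚ (+ k) 0 (coprime-sym (1-coprimeTo k))
fromℕ≡mkℚ k = ℚ.normalize-coprime (coprime-sym (1-coprimeTo k))

fromℕ-mono-≤ : ∀ {m n} → m ≤ n → fromℕ m ≤ℚ fromℕ n
fromℕ-mono-≤ {m} {n} m≤n rewrite fromℕ≡mkℚ m | fromℕ≡mkℚ n =
  ℚ.*≤* (ℤ.*-monoʳ-≤-nonNeg (+ 1) (ℤ.+≤+ m≤n))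

fromℕ-homo-+ : ∀ m n → fromℕ (m ℕ.+ n) ≡ fromℕ m + fromℕ n
fromℕ-homo-+ m n rewrite fromℕ≡mkℚ m | fromℕ≡mkℚ n =
  cong (_/ 1) (trans (ℤ.pos-+ m n) (sym (cong₂ ℤ._+_ (ℤ.*-identityʳ (+ m)) (ℤ.*-identityʳ (+ n)))))

+-cancelʳ-≤ : ∀ r {p q} → p + r ≤ℚ q + r → p ≤ℚ q
+-cancelʳ-≤ r {p} {q} p+r≤q+r = begin
  p              ≡⟨ //-rightDividesʳ r p ⟨
  p + r ℚ.- r    ≤⟨ ℚ.+-monoˡ-≤ (ℚ.- r) p+r≤q+r ⟩
  q + r ℚ.- r    ≡⟨ //-rightDividesʳ r q ⟩
  q              ∎
  where
  open ℚ.≤-Reasoning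
  open GroupProperties ℚ.+-0-group using (//-rightDividesʳ)

approximation-slack : ∀ {a k s t ε} → a + k ≤ℚ (1ℚ + ε) * s → s ≤ℚ t + k → a ≤ℚ t + ε * s
approximation-slack {a} {k} {s} {t} {ε} a+k≤[1+ε]s s≤t+k = +-cancelʳ-≤ k (begin
  a + k           ≤⟨ a+k≤[1+ε]s ⟩
  (1ℚ + ε) * s    ≡⟨ ℚ.*-distribʳ-+ s 1ℚ ε ⟩
  1ℚ * s + ε * s  ≡⟨ cong (_+ ε * s) (ℚ.*-identityˡ s) ⟩
  s + ε * s       ≤⟨ ℚ.+-monoˡ-≤ (ε * s) s≤t+k ⟩
  t + k + ε * s   ≡⟨ xy∙z≈xz∙y t k (ε * s) ⟩
  t + ε * s + k   ∎)
  where
  open ℚ.≤-Reasoning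
  open CommutativeSemigroupProperties (CommutativeMonoid.commutativeSemigroup ℚ.+-0-commutativeMonoid)
    using (xy∙z≈xz∙y)

approximation-bound : ∀ {ε} → 0ℚ ≤ℚ ε → ∀ a k {c} s t n →
                      a ℕ.+ k ≤ c → fromℕ c ≤ℚ (1ℚ + ε) * fromℕ s → s ≤ t ℕ.+ k → s ≤ n ℕ.+ n →
                      fromℕ a ≤ℚ fromℕ t + (fromℕ 2 * ε) * fromℕ n
approximation-bound {ε} 0≤ε a k {c} s t n a+k≤c c≤[1+ε]s s≤t+k s≤n+n = begin
  fromℕ a
    ≤⟨ approximation-slack {t = fromℕ t} {ε = ε} a+k≤[1+ε]s (fromℕ-mono-≤+ t k s≤t+k) ⟩
  fromℕ t + ε * fromℕ s
    ≤⟨ ℚ.+-monoʳ-≤ (fromℕ t) (ℚ.*-monoˡ-≤-nonNeg ε (fromℕ-mono-≤+ n n s≤n+n)) ⟩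
  fromℕ t + ε * (fromℕ n + fromℕ n)
    ≡⟨ cong (_+_ (fromℕ t)) (ε[N+N]≡[2ε]N ε (fromℕ n)) ⟩
  fromℕ t + (fromℕ 2 * ε) * fromℕ n
    ∎
  where
  open ℚ.≤-Reasoning
  instance _ = ℚ.nonNegative 0≤ε
  fromℕ-mono-≤+ : ∀ {x} y z → x ≤ y ℕ.+ z → fromℕ x ≤ℚ fromℕ y + fromℕ z
  fromℕ-mono-≤+ {x} y z x≤y+z = subst (fromℕ x ≤ℚ_) (fromℕ-homo-+ y z) (fromℕ-mono-≤ x≤y+z)
  a+k≤[1+ε]s : fromℕ a + fromℕ k ≤ℚ (1ℚ + ε) * fromℕ s
  a+k≤[1+ε]s = ℚ.≤-trans (subst (_≤ℚ fromℕ c) (fromℕ-homo-+ a k) (fromℕ-mono-≤ a+k≤c)) c≤[1+ε]s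
  ε[N+N]≡[2ε]N : ∀ e N → e * (N + N) ≡ (fromℕ 2 * e) * N
  ε[N+N]≡[2ε]N = solve 2 (λ e N → e :* (N :+ N) := (con 1ℚ :+ con 1ℚ) :* e :* N) refl
    where open +-*-Solver

lemma1p13 : (n p q : ℕ) → p ≤ n → q ≤ n → (E : Fin p → Fin q → Set) →
            (ε : ℚ) → 0ℚ < ε → ε < 1ℚ →
            (A : Subset p) (B : Subset q) →
            (C : VSet (G⁺ A B E)) → IsVertexCover (G⁺ A B E) C →
            (t⁺ t : ℕ) → IsTau (G⁺ A B E) t⁺ → IsTau (G[ A , B ] E) t →
            (+ size (G⁺ A B E) C / 1) ≤ℚ (1ℚ + ε) * (+ t⁺ / 1) →
            IsVertexCover (G[ A , B ] E) (restrict A B E C) ×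
            ((+ size (G[ A , B ] E) (restrict A B E C) / 1)
              ≤ℚ (+ t / 1) + ((+ 2 / 1) * ε) * (+ n / 1))
lemma1p13 n p q p≤n q≤n E ε 0<ε _ A B C C-covers t⁺ t τ⁺ τ ∣C∣≤[1+ε]t⁺ =
  restrict-isVertexCover A B E C C-covers ,
  approximation-bound (ℚ.<⇒≤ 0<ε) (size (G[ A , B ] E) (restrict A B E C)) (pendants A B) t⁺ t n
    (size-restrict+pendants≤size A B E C C-covers) ∣C∣≤[1+ε]t⁺
    (τ⁺≤τ+pendants A B E τ⁺ τ) (ℕ.≤-trans (τ⁺≤p+q A B E τ⁺) (ℕ.+-mono-≤ p≤n q≤n))
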